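{- Each of the following nonsymmetric matrices is equivalent to its transpose: $\widetilde A_1'$, $O_4'$, $S_8^-$, $L_4$, $L_n'$ (even $n\ge4$), $A_2^{\pm}$, $O_4^{\pm}$, $\widetilde C_n'$ ($n\ge3$), $B_2$, $F_4$, $G_2$, $O_4''$, $B_2^{\pm}$.
   Context: Two square matrices $A,B$ are equivalent if $P^{\mathsf T}AP=\pm B$ for some signed permutation matrix $P$. Only nonzero entries are listed; "path $v_1,\dots,v_m$" means $a_{v_tv_{t+1}}=a_{v_{t+1}v_t}=1$ unless stated otherwise. $\widetilde A_1'=\begin{pmatrix}0&1\\4&0\end{pmatrix}$, $O_4'=\begin{pmatrix}0&-1&1&0\\-1&0&0&1\\3&0&0&1\\0&3&1&0\end{pmatrix}$, $A_2^{\pm}=\begin{pmatrix}1&3\\1&-1\end{pmatrix}$, $O_4^{\pm}=\begin{pmatrix}-1&1&2&0\\1&1&0&2\\1&0&1&-1\\0&1&-1&-1\end{pmatrix}$, $O_4''=\begin{pmatrix}0&-1&1&0\\-1&0&0&1\\2&0&0&1\\0&2&1&0\end{pmatrix}$, $B_2^{\pm}=\begin{pmatrix}1&1\\2&-1\end{pmatrix}$, $B_2=\begin{pmatrix}0&1\\2&0\end{pmatrix}$, $G_2=\begin{pmatrix}0&1\\3&0\end{pmatrix}$; $F_4$: path $v_1,\dots,v_4$ except $a_{v_2v_3}=1,a_{v_3v_2}=2$; $\widetilde C_n'$: path $v_0,\dots,v_n$ except $a_{v_0v_1}=1,a_{v_1v_0}=2,a_{v_{n-1}v_n}=1,a_{v_nv_{n-1}}=2$.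 $S_8^-$: vertices $u_1,\dots,u_4,v_1,\dots,v_4$; $a_{u_1u_2}=a_{u_2u_1}=a_{u_1u_3}=a_{u_3u_1}=a_{u_3u_4}=a_{u_4u_3}=1$, $a_{u_2u_4}=a_{u_4u_2}=-1$; $a_{v_1v_3}=a_{v_3v_1}=a_{v_2v_4}=a_{v_4v_2}=a_{v_3v_4}=a_{v_4v_3}=1$, $a_{v_1v_2}=a_{v_2v_1}=-1$; $a_{u_tv_t}=2,a_{v_tu_t}=1$ ($t=1,2,4$), $a_{u_3v_3}=-2,a_{v_3u_3}=-1$. Ladder ($r\ge1$): vertices $x_1..x_r,y_1..y_r$ with, for $1\le t\le r-1$: $a_{x_tx_{t+1}}=a_{x_{t+1}x_t}=1$, $a_{y_ty_{t+1}}=a_{y_{t+1}y_t}=-1$, $a_{x_ty_{t+1}}=a_{y_{t+1}x_t}=1$, $a_{y_tx_{t+1}}=a_{x_{t+1}y_t}=-1$. $L_n$ ($n=2r+2$): ladder plus $w_0,w_1$ with $a_{w_0x_1}=a_{w_0y_1}=2$, $a_{x_1w_0}=a_{y_1w_0}=1$, $a_{w_1x_r}=2,a_{x_rw_1}=1,a_{w_1y_r}=-2,a_{y_rw_1}=-1$ (so $L_4$ is the case $r=1$). $L_n'$: as $L_n$ but $a_{w_1x_r}=1,a_{x_rw_1}=2,a_{w_1y_r}=-1,a_{y_rw_1}=-2$. -}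

module Defs where

open import Data.Nat as ℕ using (ℕ; zero; suc; _≡ᵇ_; _∸_)
open import Data.Bool using (Bool; true; false; if_then_else_; _∧_)
open import Data.Integer as ℤ using (ℤ; +_; -_; _◃_)
open import Data.Sign using (Sign)
open import Data.Fin as Fin using (Fin; toℕ)
open import Data.Fin.Permutation using (Permutation′; _⟨$⟩ʳ_)
open import Data.Vec as Vec using (Vec; []; _∷_; lookup)
open import Data.List as List using (List; []; _∷_; _++_; concatMap; upTo)
open import Data.Product using (Σ; ∃; _×_; _,_)
open import Data.Sum using (_⊎_)
open import Relation.Nullary using (does)
open import Relation.Binary.PropositionalEquality using (_≡_)

Mat : ℕ → Set
Mat n = Fin n → Fin n → ℤ

∑ : ∀ {n} → (Fin n → ℤ) → ℤ
∑ {zero}  f = + 0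
∑ {suc n} f = f Fin.zero ℤ.+ ∑ (λ i → f (Fin.suc i))

_⊗_ : ∀ {n} → Mat n → Mat n → Mat n
(A ⊗ B) i j = ∑ (λ k → A i k ℤ.* B k j)

transpose : ∀ {n} → Mat n → Mat n
transpose A i j = A j i

negM : ∀ {n} → Mat n → Mat n
negM A i j = - A i j

_≐_ : ∀ {n} → Mat n → Mat n → Set
A ≐ B = ∀ i j → A i j ≡ B i j

-- The signed permutation matrix with nonzero entries P_{σ(j), j} = ε_j ∈ {±1}.
-- Every signed permutation matrix is of this form.
signedPerm : ∀ {n} → Permutation′ n → (Fin n → Sign) → Mat n
signedPerm σ ε i j = if does (i Fin.≟ (σ ⟨$⟩ʳ j)) then ε j ◃ 1 else + 0

Equivalent : ∀ {n} → Mat n → Mat n → Set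
Equivalent {n} A B =
  Σ (Permutation′ n) λ σ → Σ (Fin n → Sign) λ ε →
    let P = signedPerm σ ε in
    ((transpose P ⊗ A) ⊗ P) ≐ B ⊎ ((transpose P ⊗ A) ⊗ P) ≐ negM B

fromRows : ∀ {n} → Vec (Vec ℤ n) n → Mat n
fromRows rows i j = lookup (lookup rows i) j

-- from a list of nonzero entries (i , j , a_ij), vertices numbered 0..n-1
Entries : Set
Entries = List (ℕ × ℕ × ℤ)

entryAt : Entries → ℕ → ℕ → ℤ
entryAt [] i j = + 0
entryAt ((a , b , v) ∷ es) i j =
  (if (a ≡ᵇ i) ∧ (b ≡ᵇ j) then v else + 0) ℤ.+ entryAt es i j

fromEntries : ∀ n → Entries → Mat n
fromEntries n es i j = entryAt es (toℕ i) (toℕ j)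

arc : ℕ → ℕ → ℤ → ℤ → Entries
arc i j a b = (i , j , a) ∷ (j , i , b) ∷ []

oneTo : ℕ → List ℕ
oneTo m = List.map suc (upTo m)

1ℤ -1ℤ : ℤ
1ℤ = + 1
-1ℤ = - + 1

Ã₁′ : Mat 2
Ã₁′ = fromRows ((+ 0 ∷ + 1 ∷ []) ∷ (+ 4 ∷ + 0 ∷ []) ∷ [])

O₄′ : Mat 4
O₄′ = fromRows ( (+ 0 ∷ -1ℤ ∷ + 1 ∷ + 0 ∷ [])
               ∷ (-1ℤ ∷ + 0 ∷ + 0 ∷ + 1 ∷ [])
               ∷ (+ 3 ∷ + 0 ∷ + 0 ∷ + 1 ∷ [])
               ∷ (+ 0 ∷ + 3 ∷ + 1 ∷ + 0 ∷ []) ∷ [])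

A₂± : Mat 2
A₂± = fromRows ((+ 1 ∷ + 3 ∷ []) ∷ (+ 1 ∷ -1ℤ ∷ []) ∷ [])

O₄± : Mat 4
O₄± = fromRows ( (-1ℤ ∷ + 1 ∷ + 2 ∷ + 0 ∷ [])
               ∷ (+ 1 ∷ + 1 ∷ + 0 ∷ + 2 ∷ [])
               ∷ (+ 1 ∷ + 0 ∷ + 1 ∷ -1ℤ ∷ [])
               ∷ (+ 0 ∷ + 1 ∷ -1ℤ ∷ -1ℤ ∷ []) ∷ [])

O₄″ : Mat 4
O₄″ = fromRows ( (+ 0 ∷ -1ℤ ∷ + 1 ∷ + 0 ∷ [])
               ∷ (-1ℤ ∷ + 0 ∷ + 0 ∷ + 1 ∷ [])
               ∷ (+ 2 ∷ + 0 ∷ + 0 ∷ + 1 ∷ [])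
               ∷ (+ 0 ∷ + 2 ∷ + 1 ∷ + 0 ∷ []) ∷ [])

B₂± : Mat 2
B₂± = fromRows ((+ 1 ∷ + 1 ∷ []) ∷ (+ 2 ∷ -1ℤ ∷ []) ∷ [])

B₂ : Mat 2
B₂ = fromRows ((+ 0 ∷ + 1 ∷ []) ∷ (+ 2 ∷ + 0 ∷ []) ∷ [])

G₂ : Mat 2
G₂ = fromRows ((+ 0 ∷ + 1 ∷ []) ∷ (+ 3 ∷ + 0 ∷ []) ∷ [])

-- F₄ : path v₁..v₄ = 0..3 with a_{v₂v₃} = 1, a_{v₃v₂} = 2
F₄ : Mat 4
F₄ = fromEntries 4 (arc 0 1 1ℤ 1ℤ ++ arc 1 2 1ℤ (+ 2) ++ arc 2 3 1ℤ 1ℤ)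

-- C̃ₙ′ : path v₀..vₙ (vertex vₜ = t), n+1 vertices
C̃′ : (n : ℕ) → Mat (suc n)
C̃′ n = fromEntries (suc n)
  (arc 0 1 1ℤ (+ 2)
   ++ concatMap (λ t → arc t (suc t) 1ℤ 1ℤ) (oneTo (n ∸ 2))
   ++ arc (n ∸ 1) n 1ℤ (+ 2))

-- S₈⁻ : uₜ = t - 1, vₜ = t + 3  (t = 1..4)
S₈⁻ : Mat 8
S₈⁻ = fromEntries 8
  ( arc 0 1 1ℤ 1ℤ ++ arc 0 2 1ℤ 1ℤ ++ arc 2 3 1ℤ 1ℤ ++ arc 1 3 -1ℤ -1ℤ
  ++ arc 4 6 1ℤ 1ℤ ++ arc 5 7 1ℤ 1ℤ ++ arc 6 7 1ℤ 1ℤ ++ arc 4 5 -1ℤ -1ℤ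
  ++ arc 0 4 (+ 2) 1ℤ ++ arc 1 5 (+ 2) 1ℤ ++ arc 3 7 (+ 2) 1ℤ
  ++ arc 2 6 (- + 2) -1ℤ)

-- Ladder matrices, n = 2r+2 vertices:
--   w₀ = 0, xₜ = t, yₜ = r + t (t = 1..r), w₁ = 2r+1

ladder : ℕ → Entries
ladder r = concatMap (λ t →
     arc t (suc t) 1ℤ 1ℤ
  ++ arc (r ℕ.+ t) (r ℕ.+ suc t) -1ℤ -1ℤ
  ++ arc t (r ℕ.+ suc t) 1ℤ 1ℤ
  ++ arc (r ℕ.+ t) (suc t) -1ℤ -1ℤ)
  (oneTo (r ∸ 1))

w₀-part : ℕ → Entries
w₀-part r = arc 0 1 (+ 2) 1ℤ ++ arc 0 (r ℕ.+ 1) (+ 2) 1ℤ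

w₁ : ℕ → ℕ
w₁ r = suc (r ℕ.+ r)

L : (r : ℕ) → Mat (suc (suc (r ℕ.+ r)))
L r = fromEntries _
  (ladder r ++ w₀-part r
   ++ arc (w₁ r) r (+ 2) 1ℤ ++ arc (w₁ r) (r ℕ.+ r) (- + 2) -1ℤ)

L′ : (r : ℕ) → Mat (suc (suc (r ℕ.+ r)))
L′ r = fromEntries _
  (ladder r ++ w₀-part r
   ++ arc (w₁ r) r 1ℤ (+ 2) ++ arc (w₁ r) (r ℕ.+ r) -1ℤ (- + 2))

SelfTransposeEquiv : ∀ {n} → Mat n → Set
SelfTransposeEquiv A = Equivalent A (transpose A)

module Submission where

-- In each case the
-- witness is a signed permutation matrix P whose permutation σ is an
-- involution (a symmetry of the underlying diagram reversing its arrows) and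
-- whose signs ε are compatible with σ.
--
-- 1. Conjugation: (Pᵀ A P)ᵢⱼ = εᵢ εⱼ A_{σ(i) σ(j)}, the "twist" of A.
-- 2. For a matrix of fixed size the twist can be compared with ±Aᵀ by
--    evaluation; this settles the eleven sporadic matrices.
-- 3. For matrices given by lists of entries (i , j , a_ij), a relabelling
--    (g , s) of the vertices twists A into Aᵀ as soon as relabelling the list
--    gives a permutation of the list with every entry transposed.
-- 4. Concatenating index blocks 1 … m in reverse order only permutes the list;
--    with this, the reflections t ↦ n − t of the path C̃′ₙ and
--    xₜ ↦ x_{r+1−t}, yₜ ↦ y_{r+1−t}, w₀ ↔ w₁ (signs −1 on the yₜ) of L′ₙ
--    are shown to be such relabellings, uniformly in n.

open import Defs
open import Algebra.Properties.CommutativeSemigroup using (xy∙z≈xz∙y)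
open import Data.Bool using (true; false; if_then_else_; _∧_; T)
open import Data.Bool.Properties using (∧-comm; T-∧)
open import Function.Bundles using (Equivalence)
open import Data.Empty using (⊥-elim)
open import Data.Fin as Fin using (Fin; toℕ; fromℕ<)
open import Data.Fin.Patterns using (0F; 1F; 2F; 3F; 4F; 5F; 6F; 7F)
open import Data.Fin.Properties using (all?; toℕ-fromℕ<; toℕ<n; toℕ-injective)
open import Data.Fin.Permutation using (Permutation′; permutation; _⟨$⟩ʳ_)
open import Data.Integer as ℤ using (ℤ; +_; -_; _◃_)
import Data.Integer.Properties as ℤP
open import Data.List using (List; []; _∷_; _++_; map; concatMap; upTo)
open import Data.List.Membership.Propositional using (_∈_)
open import Data.List.Membership.Propositional.Properties using (∈-map⁻; ∈-upTo⁻)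
open import Data.List.Properties
  using (map-++; map-concatMap; concatMap-map; concatMap-++; map-applyUpTo; applyUpTo-∷ʳ; ++-identityʳ)
open import Data.List.Relation.Binary.Permutation.Propositional
  using (_↭_; ↭-refl; ↭-trans; ↭-reflexive; prep; module PermutationReasoning)
import Data.List.Relation.Binary.Permutation.Propositional as Perm
open import Data.List.Relation.Binary.Permutation.Propositional.Properties
  using (++⁺; ++⁺ˡ; ++-comm; ++-assoc; shifts; map⁺)
open import Data.List.Relation.Unary.Any using (here; there)
open import Data.Nat as ℕ using (ℕ; zero; suc; _≡ᵇ_; _<_; _≤_; _∸_; _+_; _≤?_; s≤s; z≤n)
import Data.Nat.Properties as ℕP
open import Data.Product using (_×_; _,_; proj₁; proj₂)
open import Data.Sign using (Sign)
open import Data.Sum using (inj₁; inj₂)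
open import Data.Unit using (tt)
open import Data.Vec using (Vec; []; _∷_; lookup)
open import Relation.Nullary using (Dec; yes; no; ¬_; does; contradiction)
open import Relation.Nullary.Decidable using (True; toWitness)
open import Relation.Binary.PropositionalEquality

-- Conjugation by a signed permutation matrix

⟦_⟧ : Sign → ℤ
⟦ s ⟧ = s ◃ 1

∑-zero : ∀ {n} → ∑ {n} (λ _ → + 0) ≡ + 0
∑-zero {zero} = refl
∑-zero {suc n} = trans (ℤP.+-identityˡ _) (∑-zero {n})

∑-cong : ∀ {n} {f h : Fin n → ℤ} → (∀ i → f i ≡ h i) → ∑ f ≡ ∑ h
∑-cong {zero} e = refl
∑-cong {suc n} e = cong₂ ℤ._+_ (e Fin.zero) (∑-cong (λ i → e (Fin.suc i)))

δ : ∀ {n} → Fin n → Fin n → ℤ → ℤ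
δ m p c = if does (m Fin.≟ p) then c else + 0

∑-δˡ : ∀ {n} (p : Fin n) (c : ℤ) (f : Fin n → ℤ) → ∑ (λ m → δ m p c ℤ.* f m) ≡ c ℤ.* f p
∑-δˡ {suc n} Fin.zero c f =
  trans (cong (λ z → c ℤ.* f Fin.zero ℤ.+ z) (∑-zero {n})) (ℤP.+-identityʳ _)
∑-δˡ {suc n} (Fin.suc p) c f = trans (ℤP.+-identityˡ _) (∑-δˡ p c (λ m → f (Fin.suc m)))

∑-δʳ : ∀ {n} (p : Fin n) (c : ℤ) (f : Fin n → ℤ) → ∑ (λ m → f m ℤ.* δ m p c) ≡ f p ℤ.* c
∑-δʳ p c f = trans (∑-cong (λ m → ℤP.*-comm (f m) (δ m p c)))
                   (trans (∑-δˡ p c f) (ℤP.*-comm c (f p)))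

conjugate : ∀ {n} → Permutation′ n → (Fin n → Sign) → Mat n → Mat n
conjugate σ ε A = (transpose (signedPerm σ ε) ⊗ A) ⊗ signedPerm σ ε

twist : ∀ {n} → Mat n → (Fin n → Fin n) → (Fin n → Sign) → Mat n
twist A f ε i j = (⟦ ε i ⟧ ℤ.* ⟦ ε j ⟧) ℤ.* A (f i) (f j)

conjugate≐twist : ∀ {n} (σ : Permutation′ n) (ε : Fin n → Sign) (A : Mat n) →
  conjugate σ ε A ≐ twist A (σ ⟨$⟩ʳ_) ε
conjugate≐twist σ ε A i j = begin
  ∑ (λ k → ∑ (λ m → δ m (σ ⟨$⟩ʳ i) ⟦ ε i ⟧ ℤ.* A m k) ℤ.* δ k (σ ⟨$⟩ʳ j) ⟦ ε j ⟧)
    ≡⟨ ∑-cong (λ k → cong (ℤ._* δ k (σ ⟨$⟩ʳ j) ⟦ ε j ⟧)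
                          (∑-δˡ (σ ⟨$⟩ʳ i) ⟦ ε i ⟧ (λ m → A m k))) ⟩
  ∑ (λ k → (⟦ ε i ⟧ ℤ.* A (σ ⟨$⟩ʳ i) k) ℤ.* δ k (σ ⟨$⟩ʳ j) ⟦ ε j ⟧)
    ≡⟨ ∑-δʳ (σ ⟨$⟩ʳ j) ⟦ ε j ⟧ (λ k → ⟦ ε i ⟧ ℤ.* A (σ ⟨$⟩ʳ i) k) ⟩
  (⟦ ε i ⟧ ℤ.* A (σ ⟨$⟩ʳ i) (σ ⟨$⟩ʳ j)) ℤ.* ⟦ ε j ⟧
    ≡⟨ xy∙z≈xz∙y ℤP.*-commutativeSemigroup ⟦ ε i ⟧ _ ⟦ ε j ⟧ ⟩
  twist A (σ ⟨$⟩ʳ_) ε i j ∎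
  where open ≡-Reasoning

fromInvolution : ∀ {n} (f : Fin n → Fin n) → (∀ i → f (f i) ≡ i) → Permutation′ n
fromInvolution f inv = permutation f f inv inv

_≐?_ : ∀ {n} (A B : Mat n) → Dec (A ≐ B)
A ≐? B = all? (λ i → all? (λ j → A i j ℤ.≟ B i j))

involutive? : ∀ {n} (f : Fin n → Fin n) → Dec (∀ i → f (f i) ≡ i)
involutive? f = all? (λ i → f (f i) Fin.≟ i)

module _ {n} {A : Mat n} (f : Vec (Fin n) n) (ε : Vec Sign n)
         {isInvolution : True (involutive? (lookup f))} where

  private
    σ : Permutation′ n
    σ = fromInvolution (lookup f) (toWitness isInvolution)

  selfTranspose-by : {_ : True (twist A (lookup f) (lookup ε) ≐? transpose A)} →
    SelfTransposeEquiv A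
  selfTranspose-by {check} =
    σ , lookup ε , inj₁ (λ i j → trans (conjugate≐twist σ (lookup ε) A i j) (toWitness check i j))

  antiSelfTranspose-by : {_ : True (twist A (lookup f) (lookup ε) ≐? negM (transpose A))} →
    SelfTransposeEquiv A
  antiSelfTranspose-by {check} =
    σ , lookup ε , inj₂ (λ i j → trans (conjugate≐twist σ (lookup ε) A i j) (toWitness check i j))

-- Matrices given by lists of entries, and relabellings of their vertices

swapEntry : ℕ × ℕ × ℤ → ℕ × ℕ × ℤ
swapEntry (i , j , v) = j , i , v

T-ext : ∀ {a b} → (T a → T b) → (T b → T a) → a ≡ b
T-ext {true}  {true}  _ _ = refl
T-ext {false} {false} _ _ = refl
T-ext {true}  {false} f _ = ⊥-elim (f tt)
T-ext {false} {true}  _ h = ⊥-elim (h tt)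

entryAt-↭ : ∀ {xs ys} → xs ↭ ys → ∀ a b → entryAt xs a b ≡ entryAt ys a b
entryAt-↭ Perm.refl a b = refl
entryAt-↭ (prep (i , j , v) p) a b =
  cong (λ z → (if (i ≡ᵇ a) ∧ (j ≡ᵇ b) then v else + 0) ℤ.+ z) (entryAt-↭ p a b)
entryAt-↭ (Perm.swap {zs} {ws} (i , j , v) (i′ , j′ , v′) p) a b = begin
  x ℤ.+ (y ℤ.+ entryAt zs a b) ≡⟨ ℤP.+-assoc x y _ ⟨
  (x ℤ.+ y) ℤ.+ entryAt zs a b ≡⟨ cong₂ ℤ._+_ (ℤP.+-comm x y) (entryAt-↭ p a b) ⟩
  (y ℤ.+ x) ℤ.+ entryAt ws a b ≡⟨ ℤP.+-assoc y x _ ⟩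
  y ℤ.+ (x ℤ.+ entryAt ws a b) ∎
  where
  open ≡-Reasoning
  x = if (i ≡ᵇ a) ∧ (j ≡ᵇ b) then v else + 0
  y = if (i′ ≡ᵇ a) ∧ (j′ ≡ᵇ b) then v′ else + 0
entryAt-↭ (Perm.trans p q) a b = trans (entryAt-↭ p a b) (entryAt-↭ q a b)

entryAt-swap : ∀ es a b → entryAt (map swapEntry es) a b ≡ entryAt es b a
entryAt-swap [] a b = refl
entryAt-swap ((i , j , v) ∷ es) a b =
  cong₂ ℤ._+_ (cong (λ c → if c then v else + 0) (∧-comm (j ≡ᵇ a) (i ≡ᵇ b)))
              (entryAt-swap es a b)

if-factor : ∀ c {k k′ : ℤ} v → (T c → k′ ≡ k) →
  (if c then k′ ℤ.* v else + 0) ≡ k ℤ.* (if c then v else + 0)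
if-factor true  v e = cong (ℤ._* v) (e tt)
if-factor false {k} v e = sym (ℤP.*-zeroʳ k)

module Relabelling (g : ℕ → ℕ) (s : ℕ → Sign) where

  relabel : ℕ × ℕ × ℤ → ℕ × ℕ × ℤ
  relabel (i , j , v) = g i , g j , (⟦ s i ⟧ ℤ.* ⟦ s j ⟧) ℤ.* v

  record Mirrors (xs ys : Entries) : Set where
    constructor mirrors
    field transposed : map relabel xs ↭ map swapEntry ys

  mirrors-++ : ∀ {xs ys xs′ ys′} → Mirrors xs ys → Mirrors xs′ ys′ → Mirrors (xs ++ xs′) (ys ++ ys′)
  mirrors-++ {xs} {ys} {xs′} {ys′} (mirrors m) (mirrors m′) = mirrors (begin
    map relabel (xs ++ xs′)                    ≡⟨ map-++ relabel xs xs′ ⟩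
    map relabel xs ++ map relabel xs′          ↭⟨ ++⁺ m m′ ⟩
    map swapEntry ys ++ map swapEntry ys′      ≡⟨ map-++ swapEntry ys ys′ ⟨
    map swapEntry (ys ++ ys′)                  ∎)
    where open PermutationReasoning

  mirrors-↭ : ∀ {xs ys ys′} → Mirrors xs ys → ys ↭ ys′ → Mirrors xs ys′
  mirrors-↭ (mirrors m) p = mirrors (↭-trans m (map⁺ swapEntry p))

  module _ (involutive : ∀ a → g (g a) ≡ a) (invariant : ∀ a → s (g a) ≡ s a) where

    ≡ᵇ-relabel : ∀ x a → (g x ≡ᵇ a) ≡ (x ≡ᵇ g a)
    ≡ᵇ-relabel x a =
      T-ext (λ t → ℕP.≡⇒≡ᵇ x (g a) (trans (sym (involutive x)) (cong g (ℕP.≡ᵇ⇒≡ (g x) a t))))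
            (λ t → ℕP.≡⇒≡ᵇ (g x) a (trans (cong g (ℕP.≡ᵇ⇒≡ x (g a) t)) (involutive a)))

    sameSign : ∀ x a → T (x ≡ᵇ g a) → s x ≡ s a
    sameSign x a t = trans (cong s (ℕP.≡ᵇ⇒≡ x (g a) t)) (invariant a)

    entryAt-relabel : ∀ es a b →
      entryAt (map relabel es) a b ≡ (⟦ s a ⟧ ℤ.* ⟦ s b ⟧) ℤ.* entryAt es (g a) (g b)
    entryAt-relabel [] a b = sym (ℤP.*-zeroʳ (⟦ s a ⟧ ℤ.* ⟦ s b ⟧))
    entryAt-relabel ((i , j , v) ∷ es) a b
      rewrite ≡ᵇ-relabel i a | ≡ᵇ-relabel j b
      | ℤP.*-distribˡ-+ (⟦ s a ⟧ ℤ.* ⟦ s b ⟧) (if (i ≡ᵇ g a) ∧ (j ≡ᵇ g b) then v else + 0)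
                        (entryAt es (g a) (g b))
      = cong₂ ℤ._+_ (if-factor ((i ≡ᵇ g a) ∧ (j ≡ᵇ g b)) v signs) (entryAt-relabel es a b)
      where
      signs : T ((i ≡ᵇ g a) ∧ (j ≡ᵇ g b)) → ⟦ s i ⟧ ℤ.* ⟦ s j ⟧ ≡ ⟦ s a ⟧ ℤ.* ⟦ s b ⟧
      signs t = cong₂ (λ x y → ⟦ x ⟧ ℤ.* ⟦ y ⟧) (sameSign i a (proj₁ both)) (sameSign j b (proj₂ both))
        where both = Equivalence.to T-∧ t

restrict : ∀ {n} (g : ℕ → ℕ) → (∀ a → a < n → g a < n) → Fin n → Fin n
restrict g bound i = fromℕ< (bound (toℕ i) (toℕ<n i))

toℕ-restrict : ∀ {n} (g : ℕ → ℕ) (bound : ∀ a → a < n → g a < n) i →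
  toℕ (restrict g bound i) ≡ g (toℕ i)
toℕ-restrict g bound i = toℕ-fromℕ< _

restrict-involutive : ∀ {n} (g : ℕ → ℕ) (bound : ∀ a → a < n → g a < n) →
  (∀ a → g (g a) ≡ a) → ∀ i → restrict g bound (restrict g bound i) ≡ i
restrict-involutive g bound involutive i = toℕ-injective (begin
  toℕ (restrict g bound (restrict g bound i)) ≡⟨ toℕ-restrict g bound _ ⟩
  g (toℕ (restrict g bound i))                ≡⟨ cong g (toℕ-restrict g bound i) ⟩
  g (g (toℕ i))                               ≡⟨ involutive (toℕ i) ⟩
  toℕ i                                       ∎)
  where open ≡-Reasoning

fromEntries-selfTranspose : ∀ n es (g : ℕ → ℕ) (s : ℕ → Sign) →
  (∀ a → g (g a) ≡ a) → (∀ a → s (g a) ≡ s a) → (∀ a → a < n → g a < n) →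
  Relabelling.Mirrors g s es es → SelfTransposeEquiv (fromEntries n es)
fromEntries-selfTranspose n es g s involutive invariant bound mirrored =
  σ , ε , inj₁ (λ i j → trans (conjugate≐twist σ ε _ i j) (twist≐transpose i j))
  where
  open Relabelling g s
  f : Fin n → Fin n
  f = restrict g bound
  σ : Permutation′ n
  σ = fromInvolution f (restrict-involutive g bound involutive)
  ε : Fin n → Sign
  ε i = s (toℕ i)
  twist≐transpose : ∀ i j → twist (fromEntries n es) f ε i j ≡ entryAt es (toℕ j) (toℕ i)
  twist≐transpose i j = begin
    (⟦ s a ⟧ ℤ.* ⟦ s b ⟧) ℤ.* entryAt es (toℕ (f i)) (toℕ (f j))
      ≡⟨ cong₂ (λ x y → (⟦ s a ⟧ ℤ.* ⟦ s b ⟧) ℤ.* entryAt es x y)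
               (toℕ-restrict g bound i) (toℕ-restrict g bound j) ⟩
    (⟦ s a ⟧ ℤ.* ⟦ s b ⟧) ℤ.* entryAt es (g a) (g b)
      ≡⟨ entryAt-relabel involutive invariant es a b ⟨
    entryAt (map relabel es) a b   ≡⟨ entryAt-↭ (Mirrors.transposed mirrored) a b ⟩
    entryAt (map swapEntry es) a b ≡⟨ entryAt-swap es a b ⟩
    entryAt es b a                 ∎
    where
    open ≡-Reasoning
    a = toℕ i
    b = toℕ j

oneTo-∷ : ∀ m → oneTo (suc m) ≡ 1 ∷ map suc (oneTo m)
oneTo-∷ m = cong (λ l → 1 ∷ map suc l) (sym (map-applyUpTo (λ x → x) suc m))

oneTo-∷ʳ : ∀ m → oneTo (suc m) ≡ oneTo m ++ (suc m ∷ [])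
oneTo-∷ʳ m = trans (cong (map suc) (sym (applyUpTo-∷ʳ (λ x → x) m))) (map-++ suc (upTo m) (m ∷ []))

oneTo-∈ : ∀ {m t} → t ∈ oneTo m → 1 ≤ t × t ≤ m
oneTo-∈ p with ∈-map⁻ suc p
... | _ , q , refl = s≤s z≤n , ∈-upTo⁻ q

reverse-three : ∀ {A : Set} (xs ys zs : List A) → zs ++ ys ++ xs ↭ xs ++ ys ++ zs
reverse-three xs ys zs = begin
  zs ++ ys ++ xs   ↭⟨ ++-comm zs (ys ++ xs) ⟩
  (ys ++ xs) ++ zs ↭⟨ ++-assoc ys xs zs ⟩
  ys ++ xs ++ zs   ↭⟨ shifts ys xs ⟩
  xs ++ ys ++ zs   ∎
  where open PermutationReasoning

concatMap-↭ : ∀ {A B : Set} (xs : List A) {f h : A → List B} →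
  (∀ {x} → x ∈ xs → f x ↭ h x) → concatMap f xs ↭ concatMap h xs
concatMap-↭ [] e = ↭-refl
concatMap-↭ (x ∷ xs) e = ++⁺ (e (here refl)) (concatMap-↭ xs (λ p → e (there p)))

concatMap-reverse : ∀ {B : Set} (h : ℕ → List B) m →
  concatMap (λ t → h (suc m ∸ t)) (oneTo m) ↭ concatMap h (oneTo m)
concatMap-reverse h zero = ↭-refl
concatMap-reverse h (suc m) = begin
  concatMap (λ t → h (suc (suc m) ∸ t)) (oneTo (suc m))
    ≡⟨ cong (concatMap (λ t → h (suc (suc m) ∸ t))) (oneTo-∷ m) ⟩
  h (suc m) ++ concatMap (λ t → h (suc (suc m) ∸ t)) (map suc (oneTo m))
    ≡⟨ cong (h (suc m) ++_) (concatMap-map (λ t → h (suc (suc m) ∸ t)) suc (oneTo m)) ⟩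
  h (suc m) ++ concatMap (λ t → h (suc m ∸ t)) (oneTo m)
    ↭⟨ ++⁺ˡ (h (suc m)) (concatMap-reverse h m) ⟩
  h (suc m) ++ concatMap h (oneTo m)
    ↭⟨ ++-comm (h (suc m)) (concatMap h (oneTo m)) ⟩
  concatMap h (oneTo m) ++ h (suc m)
    ≡⟨ cong (concatMap h (oneTo m) ++_) (++-identityʳ (h (suc m))) ⟨
  concatMap h (oneTo m) ++ concatMap h (suc m ∷ [])
    ≡⟨ concatMap-++ h (oneTo m) (suc m ∷ []) ⟨
  concatMap h (oneTo m ++ (suc m ∷ []))
    ≡⟨ cong (concatMap h) (oneTo-∷ʳ m) ⟨
  concatMap h (oneTo (suc m)) ∎
  where open PermutationReasoning

mirrors-reversed-blocks : ∀ (g : ℕ → ℕ) (s : ℕ → Sign) (F : ℕ → Entries) m →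
  (∀ {t} → 1 ≤ t → t ≤ m → Relabelling.Mirrors g s (F t) (F (suc m ∸ t))) →
  Relabelling.Mirrors g s (concatMap F (oneTo m)) (concatMap F (oneTo m))
mirrors-reversed-blocks g s F m blocks = mirrors (begin
  map relabel (concatMap F (oneTo m))
    ≡⟨ map-concatMap relabel F (oneTo m) ⟩
  concatMap (λ t → map relabel (F t)) (oneTo m)
    ↭⟨ concatMap-↭ (oneTo m) (λ t∈ → Mirrors.transposed (blocks (proj₁ (oneTo-∈ t∈)) (proj₂ (oneTo-∈ t∈)))) ⟩
  concatMap (λ t → map swapEntry (F (suc m ∸ t))) (oneTo m)
    ↭⟨ concatMap-reverse (λ t → map swapEntry (F t)) m ⟩
  concatMap (λ t → map swapEntry (F t)) (oneTo m)
    ≡⟨ map-concatMap swapEntry F (oneTo m) ⟨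
  map swapEntry (concatMap F (oneTo m)) ∎)
  where
  open Relabelling g s
  open PermutationReasoning

-- The path C̃′ₙ, n ≥ 3: the reflection t ↦ n − t

module Reflection (N : ℕ) where

  reflect : ℕ → ℕ
  reflect a with a ≤? N
  ... | yes _ = N ∸ a
  ... | no _  = a

  reflect-≤ : ∀ {a} → a ≤ N → reflect a ≡ N ∸ a
  reflect-≤ {a} a≤N with a ≤? N
  ... | yes _ = refl
  ... | no a≰N = contradiction a≤N a≰N

  reflect-≰ : ∀ {a} → ¬ a ≤ N → reflect a ≡ a
  reflect-≰ {a} a≰N with a ≤? N
  ... | yes a≤N = contradiction a≤N a≰N
  ... | no _ = refl

  reflect-involutive : ∀ a → reflect (reflect a) ≡ a
  reflect-involutive a with a ≤? N
  ... | yes a≤N = trans (reflect-≤ (ℕP.m∸n≤m N a)) (ℕP.m∸[m∸n]≡n a≤N)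
  ... | no a≰N = reflect-≰ a≰N

  reflect-< : ∀ a → a < suc N → reflect a < suc N
  reflect-< a (s≤s a≤N) rewrite reflect-≤ a≤N = s≤s (ℕP.m∸n≤m N a)

module PathC̃′ (k : ℕ) where

  N : ℕ
  N = suc (suc (suc k))

  pathArc : ℕ → Entries
  pathArc t = arc t (suc t) 1ℤ 1ℤ

  first middle last : Entries
  first  = arc 0 1 1ℤ (+ 2)
  middle = concatMap pathArc (oneTo (suc k))
  last   = arc (suc (suc k)) N 1ℤ (+ 2)

  open Reflection N
  open Relabelling reflect (λ _ → Sign.+)

  relabel-first : map relabel first ≡ map swapEntry last
  relabel-first rewrite reflect-≤ {0} z≤n | reflect-≤ {1} (s≤s z≤n) = refl

  relabel-last : map relabel last ≡ map swapEntry first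
  relabel-last rewrite reflect-≤ {suc (suc k)} (ℕP.n≤1+n _) | reflect-≤ {N} ℕP.≤-refl
    | ℕP.m+n∸n≡m 1 k | ℕP.n∸n≡0 k = refl

  relabel-pathArc : ∀ {t} → 1 ≤ t → t ≤ suc k →
    map relabel (pathArc t) ≡ map swapEntry (pathArc (suc (suc k) ∸ t))
  relabel-pathArc {t} _ t≤k+1
    rewrite reflect-≤ {t} (ℕP.≤-trans t≤k+1 (ℕP.≤-trans (ℕP.n≤1+n _) (ℕP.n≤1+n _)))
          | reflect-≤ {suc t} (s≤s (ℕP.≤-trans t≤k+1 (ℕP.n≤1+n _)))
          | ℕP.+-∸-assoc 1 {suc (suc k)} {t} (ℕP.≤-trans t≤k+1 (ℕP.n≤1+n _)) = refl

  middle-to-middle : Mirrors middle middle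
  middle-to-middle = mirrors-reversed-blocks reflect (λ _ → Sign.+) pathArc (suc k)
                       (λ 1≤t t≤k+1 → mirrors (↭-reflexive (relabel-pathArc 1≤t t≤k+1)))

  mirrored : Mirrors (first ++ middle ++ last) (first ++ middle ++ last)
  mirrored = mirrors-↭ (mirrors-++ (mirrors (↭-reflexive relabel-first))
                         (mirrors-++ middle-to-middle (mirrors (↭-reflexive relabel-last))))
                       (reverse-three first middle last)

  selfTranspose : SelfTransposeEquiv (C̃′ N)
  selfTranspose = fromEntries-selfTranspose (suc N) (first ++ middle ++ last) reflect (λ _ → Sign.+)
                    reflect-involutive (λ _ → refl) reflect-< mirrored

-- The ladder L′ₙ, n = 2r + 2 ≥ 4: vertices w₀ = 0, xₜ = t, yₜ = r + t,
-- w₁ = 2r + 1.  The relabelling xₜ ↦ x_{r+1−t}, yₜ ↦ y_{r+1−t}, w₀ ↔ w₁,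
-- with sign −1 exactly on the yₜ, mirrors the ladder onto itself.

module LadderL′ (q : ℕ) where

  r W : ℕ
  r = suc q
  W = w₁ r

  opposite-range : ∀ {t} → 1 ≤ t → t ≤ r → 1 ≤ suc r ∸ t × suc r ∸ t ≤ r
  opposite-range {t} 1≤t t≤r rewrite ℕP.+-∸-assoc 1 t≤r = s≤s z≤n , ℕP.∸-monoʳ-< {r} {t} {0} 1≤t t≤r

  opposite-involutive : ∀ {t} → t ≤ r → suc r ∸ (suc r ∸ t) ≡ t
  opposite-involutive t≤r = ℕP.m∸[m∸n]≡n (ℕP.≤-trans t≤r (ℕP.n≤1+n r))

  r+t≰r : ∀ {t} → 1 ≤ t → ¬ (r + t ≤ r)
  r+t≰r 1≤t = ℕP.<⇒≱ (ℕP.m<m+n r 1≤t)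

  W≰r+r : ¬ (W ≤ r + r)
  W≰r+r = ℕP.<⇒≱ ℕP.≤-refl

  W≰r : ¬ (W ≤ r)
  W≰r W≤r = W≰r+r (ℕP.≤-trans W≤r (ℕP.m≤m+n r r))

  data Region : ℕ → Set where
    w₀-region : Region 0
    x-region  : ∀ t → 1 ≤ t → t ≤ r → Region t
    y-region  : ∀ t → 1 ≤ t → t ≤ r → Region (r + t)
    w₁-region : Region W
    outside   : ∀ a → W < a → Region a

  region : ∀ a → Region a
  region zero = w₀-region
  region (suc b) with suc b ≤? r
  ... | yes b<r = x-region (suc b) (s≤s z≤n) b<r
  ... | no b≮r with suc b ≤? r + r
  ...   | yes b<r+r = subst Region (ℕP.m+[n∸m]≡n (ℕP.<⇒≤ r<b+1))
                        (y-region (suc b ∸ r) (ℕP.m<n⇒0<n∸m r<b+1)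
                          (subst (suc b ∸ r ≤_) (ℕP.m+n∸n≡m r r) (ℕP.∸-monoˡ-≤ r b<r+r)))
    where r<b+1 = ℕP.≰⇒> b≮r
  ...   | no b≮r+r with suc b ℕ.≟ W
  ...     | yes b+1≡W = subst Region (sym b+1≡W) w₁-region
  ...     | no b+1≢W = outside (suc b) (ℕP.≤∧≢⇒< (ℕP.≰⇒> b≮r+r) (λ e → b+1≢W (sym e)))

  -- w₀ ↔ w₁, xₜ ↔ x_{r+1−t}, yₜ ↔ y_{r+1−t}; larger numbers are fixed
  relabelling : ℕ → ℕ
  relabelling zero = W
  relabelling (suc b) with suc b ≤? r
  ... | yes _ = suc r ∸ suc b
  ... | no _ with suc b ≤? r + r
  ...   | yes _ = (r + W) ∸ suc b
  ...   | no _ with suc b ℕ.≟ W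
  ...     | yes _ = 0
  ...     | no _ = suc b

  sign : ℕ → Sign
  sign a with a ≤? r
  ... | yes _ = Sign.+
  ... | no _ with a ≤? r + r
  ...   | yes _ = Sign.-
  ...   | no _ = Sign.+

  relabelling-x : ∀ {t} → 1 ≤ t → t ≤ r → relabelling t ≡ suc r ∸ t
  relabelling-x {suc b} _ t≤r with suc b ≤? r
  ... | yes _ = refl
  ... | no t≰r = contradiction t≤r t≰r

  relabelling-y : ∀ {t} → 1 ≤ t → t ≤ r → relabelling (r + t) ≡ r + (suc r ∸ t)
  relabelling-y {t} 1≤t t≤r with r + t ≤? r
  ... | yes r+t≤r = contradiction r+t≤r (r+t≰r 1≤t)
  ... | no _ with r + t ≤? r + r
  ...   | no r+t≰r+r = contradiction (ℕP.+-monoʳ-≤ r t≤r) r+t≰r+r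
  ...   | yes _ = begin
    (r + W) ∸ (r + t)   ≡⟨ ℕP.[m+n]∸[m+o]≡n∸o r W t ⟩
    W ∸ t               ≡⟨ cong (_∸ t) (ℕP.+-suc r r) ⟨
    (r + suc r) ∸ t     ≡⟨ ℕP.+-∸-assoc r (ℕP.≤-trans t≤r (ℕP.n≤1+n r)) ⟩
    r + (suc r ∸ t)     ∎
    where open ≡-Reasoning

  relabelling-w₁ : relabelling W ≡ 0
  relabelling-w₁ with W ≤? r
  ... | yes W≤r = contradiction W≤r W≰r
  ... | no _ with W ≤? r + r
  ...   | yes W≤r+r = contradiction W≤r+r W≰r+r
  ...   | no _ with W ℕ.≟ W
  ...     | yes _ = refl
  ...     | no W≢W = contradiction refl W≢W

  relabelling-outside : ∀ {a} → W < a → relabelling a ≡ a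
  relabelling-outside {suc b} W<a with suc b ≤? r
  ... | yes a≤r = contradiction (ℕP.≤-trans a≤r (ℕP.≤-trans (ℕP.m≤m+n r r) (ℕP.n≤1+n _))) (ℕP.<⇒≱ W<a)
  ... | no _ with suc b ≤? r + r
  ...   | yes a≤r+r = contradiction (ℕP.≤-trans a≤r+r (ℕP.n≤1+n _)) (ℕP.<⇒≱ W<a)
  ...   | no _ with suc b ℕ.≟ W
  ...     | yes a≡W = contradiction (sym a≡W) (ℕP.<⇒≢ W<a)
  ...     | no _ = refl

  sign-x : ∀ {a} → a ≤ r → sign a ≡ Sign.+
  sign-x {a} a≤r with a ≤? r
  ... | yes _ = refl
  ... | no a≰r = contradiction a≤r a≰r

  sign-y : ∀ {t} → 1 ≤ t → t ≤ r → sign (r + t) ≡ Sign.-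
  sign-y {t} 1≤t t≤r with r + t ≤? r
  ... | yes r+t≤r = contradiction r+t≤r (r+t≰r 1≤t)
  ... | no _ with r + t ≤? r + r
  ...   | no r+t≰r+r = contradiction (ℕP.+-monoʳ-≤ r t≤r) r+t≰r+r
  ...   | yes _ = refl

  sign-w₁ : sign W ≡ Sign.+
  sign-w₁ with W ≤? r
  ... | yes _ = refl
  ... | no _ with W ≤? r + r
  ...   | yes W≤r+r = contradiction W≤r+r W≰r+r
  ...   | no _ = refl

  relabelling-involutive : ∀ a → relabelling (relabelling a) ≡ a
  relabelling-involutive a with region a
  ... | w₀-region = relabelling-w₁
  ... | x-region t 1≤t t≤r with opposite-range 1≤t t≤r
  ...   | 1≤u , u≤r = trans (cong relabelling (relabelling-x 1≤t t≤r))
                        (trans (relabelling-x 1≤u u≤r) (opposite-involutive t≤r))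
  relabelling-involutive a | y-region t 1≤t t≤r with opposite-range 1≤t t≤r
  ...   | 1≤u , u≤r = trans (cong relabelling (relabelling-y 1≤t t≤r))
                        (trans (relabelling-y 1≤u u≤r) (cong (λ u → r + u) (opposite-involutive t≤r)))
  relabelling-involutive a | w₁-region = cong relabelling relabelling-w₁
  relabelling-involutive a | outside .a W<a =
    trans (cong relabelling (relabelling-outside W<a)) (relabelling-outside W<a)

  relabelling-< : ∀ a → a < suc W → relabelling a < suc W
  relabelling-< a a<n with region a
  ... | w₀-region = ℕP.≤-refl
  ... | x-region t 1≤t t≤r rewrite relabelling-x 1≤t t≤r =
    s≤s (ℕP.≤-trans (proj₂ (opposite-range 1≤t t≤r)) (ℕP.≤-trans (ℕP.m≤m+n r r) (ℕP.n≤1+n _)))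
  ... | y-region t 1≤t t≤r rewrite relabelling-y 1≤t t≤r =
    s≤s (ℕP.≤-trans (ℕP.+-monoʳ-≤ r (proj₂ (opposite-range 1≤t t≤r))) (ℕP.n≤1+n _))
  ... | w₁-region rewrite relabelling-w₁ = s≤s z≤n
  ... | outside .a W<a = contradiction a<n (ℕP.<⇒≱ (s≤s W<a))

  sign-invariant : ∀ a → sign (relabelling a) ≡ sign a
  sign-invariant a with region a
  ... | w₀-region = trans sign-w₁ (sym (sign-x z≤n))
  ... | x-region t 1≤t t≤r rewrite relabelling-x 1≤t t≤r =
    trans (sign-x (proj₂ (opposite-range 1≤t t≤r))) (sym (sign-x t≤r))
  ... | y-region t 1≤t t≤r rewrite relabelling-y 1≤t t≤r =
    trans (sign-y (proj₁ (opposite-range 1≤t t≤r)) (proj₂ (opposite-range 1≤t t≤r))) (sym (sign-y 1≤t t≤r))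
  ... | w₁-region rewrite relabelling-w₁ = trans (sign-x z≤n) (sym sign-w₁)
  ... | outside .a W<a rewrite relabelling-outside W<a = refl

  open Relabelling relabelling sign

  rung : ℕ → Entries
  rung t = arc t (suc t) 1ℤ 1ℤ
        ++ arc (r + t) (r + suc t) -1ℤ -1ℤ
        ++ arc t (r + suc t) 1ℤ 1ℤ
        ++ arc (r + t) (suc t) -1ℤ -1ℤ

  rung-reordered : ℕ → Entries
  rung-reordered t = arc t (suc t) 1ℤ 1ℤ
                  ++ arc (r + t) (r + suc t) -1ℤ -1ℤ
                  ++ arc (r + t) (suc t) -1ℤ -1ℤ
                  ++ arc t (r + suc t) 1ℤ 1ℤ

  rung-reordered-↭ : ∀ t → rung-reordered t ↭ rung t
  rung-reordered-↭ t = ++⁺ˡ (arc t (suc t) 1ℤ 1ℤ ++ arc (r + t) (r + suc t) -1ℤ -1ℤ)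
                         (++-comm (arc (r + t) (suc t) -1ℤ -1ℤ) (arc t (r + suc t) 1ℤ 1ℤ))

  -- rung t is carried to rung r − t, its two diagonals exchanging roles
  relabel-rung : ∀ {t} → 1 ≤ t → t ≤ q →
    map relabel (rung t) ≡ map swapEntry (rung-reordered (suc q ∸ t))
  relabel-rung {t} 1≤t t≤q
    rewrite relabelling-x {t} 1≤t (ℕP.≤-trans t≤q (ℕP.n≤1+n q))
          | relabelling-x {suc t} (s≤s z≤n) (s≤s t≤q)
          | relabelling-y {t} 1≤t (ℕP.≤-trans t≤q (ℕP.n≤1+n q))
          | relabelling-y {suc t} (s≤s z≤n) (s≤s t≤q)
          | sign-x {t} (ℕP.≤-trans t≤q (ℕP.n≤1+n q))
          | sign-x {suc t} (s≤s t≤q)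
          | sign-y {t} 1≤t (ℕP.≤-trans t≤q (ℕP.n≤1+n q))
          | sign-y {suc t} (s≤s z≤n) (s≤s t≤q)
          | ℕP.+-∸-assoc 1 {r} {t} (ℕP.≤-trans t≤q (ℕP.n≤1+n q)) = refl

  ladder-mirrored : Mirrors (ladder r) (ladder r)
  ladder-mirrored = mirrors-reversed-blocks relabelling sign rung q (λ 1≤t t≤q →
    mirrors (↭-trans (↭-reflexive (relabel-rung 1≤t t≤q)) (map⁺ swapEntry (rung-reordered-↭ _))))

  ends : Entries
  ends = arc W r 1ℤ (+ 2) ++ arc W (r + r) -1ℤ (- + 2)

  relabel-w₀ : map relabel (w₀-part r) ↭ map swapEntry ends
  relabel-w₀ rewrite relabelling-x {1} (s≤s z≤n) (s≤s z≤n) | relabelling-y {1} (s≤s z≤n) (s≤s z≤n)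
    | sign-x {0} z≤n | sign-x {1} (s≤s z≤n) | sign-y {1} (s≤s z≤n) (s≤s z≤n) =
    Perm.swap _ _ (Perm.swap _ _ ↭-refl)

  relabel-ends : map relabel ends ↭ map swapEntry (w₀-part r)
  relabel-ends rewrite relabelling-w₁ | relabelling-x {r} (s≤s z≤n) ℕP.≤-refl
    | relabelling-y {r} (s≤s z≤n) ℕP.≤-refl | sign-w₁ | sign-x {r} ℕP.≤-refl
    | sign-y {r} (s≤s z≤n) ℕP.≤-refl | ℕP.m+n∸n≡m 1 r =
    Perm.swap _ _ (Perm.swap _ _ ↭-refl)

  mirrored : Mirrors (ladder r ++ w₀-part r ++ ends) (ladder r ++ w₀-part r ++ ends)
  mirrored = mirrors-↭ (mirrors-++ ladder-mirrored (mirrors-++ (mirrors relabel-w₀) (mirrors relabel-ends)))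
                       (++⁺ˡ (ladder r) (++-comm ends (w₀-part r)))

  selfTranspose : SelfTransposeEquiv (L′ r)
  selfTranspose = fromEntries-selfTranspose (suc W) (ladder r ++ w₀-part r ++ ends) relabelling sign
                    relabelling-involutive sign-invariant relabelling-< mirrored

Ã₁′-selfTranspose : SelfTransposeEquiv Ã₁′
Ã₁′-selfTranspose = selfTranspose-by (1F ∷ 0F ∷ []) (Sign.+ ∷ Sign.+ ∷ [])

O₄′-selfTranspose : SelfTransposeEquiv O₄′
O₄′-selfTranspose = selfTranspose-by (2F ∷ 3F ∷ 0F ∷ 1F ∷ []) (Sign.+ ∷ Sign.- ∷ Sign.+ ∷ Sign.- ∷ [])

S₈⁻-selfTranspose : SelfTransposeEquiv S₈⁻
S₈⁻-selfTranspose = selfTranspose-by (4F ∷ 5F ∷ 6F ∷ 7F ∷ 0F ∷ 1F ∷ 2F ∷ 3F ∷ [])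
  (Sign.+ ∷ Sign.- ∷ Sign.+ ∷ Sign.+ ∷ Sign.+ ∷ Sign.- ∷ Sign.+ ∷ Sign.+ ∷ [])

L₄-selfTranspose : SelfTransposeEquiv (L 1)
L₄-selfTranspose = selfTranspose-by (1F ∷ 0F ∷ 3F ∷ 2F ∷ []) (Sign.+ ∷ Sign.+ ∷ Sign.+ ∷ Sign.+ ∷ [])

A₂±-selfTranspose : SelfTransposeEquiv A₂±
A₂±-selfTranspose = antiSelfTranspose-by (1F ∷ 0F ∷ []) (Sign.+ ∷ Sign.- ∷ [])

O₄±-selfTranspose : SelfTransposeEquiv O₄±
O₄±-selfTranspose = antiSelfTranspose-by (2F ∷ 3F ∷ 0F ∷ 1F ∷ []) (Sign.+ ∷ Sign.+ ∷ Sign.- ∷ Sign.- ∷ [])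

B₂-selfTranspose : SelfTransposeEquiv B₂
B₂-selfTranspose = selfTranspose-by (1F ∷ 0F ∷ []) (Sign.+ ∷ Sign.+ ∷ [])

F₄-selfTranspose : SelfTransposeEquiv F₄
F₄-selfTranspose = selfTranspose-by (3F ∷ 2F ∷ 1F ∷ 0F ∷ []) (Sign.+ ∷ Sign.+ ∷ Sign.+ ∷ Sign.+ ∷ [])

G₂-selfTranspose : SelfTransposeEquiv G₂
G₂-selfTranspose = selfTranspose-by (1F ∷ 0F ∷ []) (Sign.+ ∷ Sign.+ ∷ [])

O₄″-selfTranspose : SelfTransposeEquiv O₄″
O₄″-selfTranspose = selfTranspose-by (2F ∷ 3F ∷ 0F ∷ 1F ∷ []) (Sign.+ ∷ Sign.- ∷ Sign.+ ∷ Sign.- ∷ [])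

B₂±-selfTranspose : SelfTransposeEquiv B₂±
B₂±-selfTranspose = antiSelfTranspose-by (1F ∷ 0F ∷ []) (Sign.+ ∷ Sign.- ∷ [])

C̃′-selfTranspose : (n : ℕ) → 3 ≤ n → SelfTransposeEquiv (C̃′ n)
C̃′-selfTranspose (suc (suc (suc k))) (s≤s (s≤s (s≤s z≤n))) = PathC̃′.selfTranspose k

L′-selfTranspose : (r : ℕ) → 1 ≤ r → SelfTransposeEquiv (L′ r)
L′-selfTranspose (suc q) _ = LadderL′.selfTranspose q

lemma25 :
    SelfTransposeEquiv Ã₁′ ×
    SelfTransposeEquiv O₄′ ×
    SelfTransposeEquiv S₈⁻ ×
    SelfTransposeEquiv (L 1) ×
    ((r : ℕ) → 1 ≤ r → SelfTransposeEquiv (L′ r)) ×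
    SelfTransposeEquiv A₂± ×
    SelfTransposeEquiv O₄± ×
    ((n : ℕ) → 3 ≤ n → SelfTransposeEquiv (C̃′ n)) ×
    SelfTransposeEquiv B₂ ×
    SelfTransposeEquiv F₄ ×
    SelfTransposeEquiv G₂ ×
    SelfTransposeEquiv O₄″ ×
    SelfTransposeEquiv B₂±
lemma25 =
  Ã₁′-selfTranspose , O₄′-selfTranspose , S₈⁻-selfTranspose , L₄-selfTranspose ,
  L′-selfTranspose , A₂±-selfTranspose , O₄±-selfTranspose , C̃′-selfTranspose ,
  B₂-selfTranspose , F₄-selfTranspose , G₂-selfTranspose , O₄″-selfTranspose , B₂±-selfTranspose
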